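{- Let $P$ be a finite poset, and suppose that constants $c_{p^+},c_{p^- }\in\mathbb{R}$ ($p\in P$) and $\delta\in\mathbb{R}$ satisfy the equality of functions $J(P)\to\mathbb{R}$ \[\sum_{p\in P}c_{p^+}\mathcal{T}_{p^+}+c_{p^- }\mathcal{T}_{p^- }=\delta.\] Then for every $f\in\mathcal{O}(P)$, \[\sum_{p\in P}c_{p^+}\mathcal{T}^{\mathrm{PL}}_{p^+}(f)+c_{p^- }\mathcal{T}^{\mathrm{PL}}_{p^- }(f)=\delta.\]
   Context: $J(P)$ is the set of order ideals of $P$. For $p\in P$ the toggle $\tau_p\colon J(P)\to J(P)$ is $\tau_p(I)=I\cup\{p\}$ if $p\notin I$ and $I\cup\{p\}\in J(P)$; $I\setminus\{p\}$ if $p\in I$ and $I\setminus\{p\}\in J(P)$; $I$ otherwise. $\mathcal{T}_{p^+}(I)=1$ if $I\subsetneq\tau_p(I)$, else $0$; $\mathcal{T}_{p^- }(I)=1$ if $\tau_p(I)\subsetneq I$, else $0$. The order polytope $\mathcal{O}(P)\subseteq\mathbb{R}^P$ is the set of $f\colon P\to\mathbb{R}$ with $0\leq f(p)\leq1$ for all $p$ and $f(p)\leq f(q)$ whenever $p\leq q$. Let $\widehat P$ be $P$ with a new minimum $\widehat0$ and maximum $\widehat1$, and regard $f\in\mathbb{R}^P$ as a function on $\widehat P$ with $f(\widehat0)=0$, $f(\widehat1)=1$. Define $\mathcal{T}^{\mathrm{PL}}_{p^+}(f)=f(p)-\max\{f(q): p\text{ covers }q\in\widehat P\}$ and $\mathcal{T}^{\mathrm{PL}}_{p^-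 }(f)=\min\{f(q): q\in\widehat P\text{ covers }p\}-f(p)$. -}

module Defs where

open import Level using (Level; _⊔_) renaming (suc to lsuc)
open import Data.Nat using (ℕ; zero; suc)
open import Data.Fin using (Fin)
open import Data.Fin.Properties using (all?; _≟_)
open import Data.Fin.Subset using (Subset; _∈_; _∪_; _∩_; ∁; ⁅_⁆; _⊂_)
open import Data.Fin.Subset.Properties using (_∈?_; _⊂?_)
open import Data.Bool using (Bool; true; false; if_then_else_; _∧_; not)
open import Data.List using (List; []; _∷_; map; filterᵇ; foldr; _++_)
open import Data.Bool.ListAction using (any)
open import Data.List.Base using () renaming (allFin to allFinL)
open import Data.Product using (_×_; ∃)
open import Relation.Nullary using (¬_; Dec; yes; no; does)
open import Relation.Nullary.Decidable using (_→-dec_)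
open import Relation.Binary using (IsPartialOrder; IsTotalOrder; Decidable)
open import Relation.Binary.PropositionalEquality using (_≡_)
open import Algebra.Bundles using (CommutativeRing)

-- Scalars: an arbitrary linearly ordered field (ℝ is an instance).
-- Equality is the setoid equality ≈ of the underlying commutative ring.

record OrderedField (c ℓ : Level) : Set (lsuc (c ⊔ ℓ)) where
  field
    commutativeRing : CommutativeRing c ℓ
  open CommutativeRing commutativeRing public
  infix 4 _≤_
  field
    _≤_          : Carrier → Carrier → Set ℓ
    isTotalOrder : IsTotalOrder _≈_ _≤_
    _≤?_         : Decidable _≤_
    0≉1          : ¬ (0# ≈ 1#)
    +-mono-≤     : ∀ {a b} d → a ≤ b → a + d ≤ b + d
    *-nonneg     : ∀ {a b} → 0# ≤ a → 0# ≤ b → 0# ≤ a * b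
    inverse      : ∀ a → ¬ (a ≈ 0#) → ∃ λ b → a * b ≈ 1#

  max : Carrier → Carrier → Carrier
  max a b = if does (a ≤? b) then b else a

  min : Carrier → Carrier → Carrier
  min a b = if does (a ≤? b) then a else b

record FinPoset : Set₁ where
  infix 4 _≼_
  field
    size           : ℕ
    _≼_            : Fin size → Fin size → Set
    isPartialOrder : IsPartialOrder _≡_ _≼_
    _≼?_           : Decidable _≼_

module Combinatorial (P : FinPoset) where
  open FinPoset P

  IsIdeal : Subset size → Set
  IsIdeal I = ∀ p q → q ≼ p → p ∈ I → q ∈ I

  isIdeal? : (I : Subset size) → Dec (IsIdeal I)
  isIdeal? I = all? λ p → all? λ q → (q ≼? p) →-dec ((p ∈? I) →-dec (q ∈? I))

  -- the toggle τ_p (applied to subsets; we only use it on ideals)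
  toggle : Fin size → Subset size → Subset size
  toggle p I with p ∈? I
  ... | no _  = if does (isIdeal? (I ∪ ⁅ p ⁆)) then I ∪ ⁅ p ⁆ else I
  ... | yes _ = if does (isIdeal? (I ∩ ∁ ⁅ p ⁆)) then I ∩ ∁ ⁅ p ⁆ else I

module Indicators {c ℓ} (F : OrderedField c ℓ) (P : FinPoset) where
  open OrderedField F
  open FinPoset P
  open Combinatorial P

  T⁺ : Fin size → Subset size → Carrier
  T⁺ p I = if does (I ⊂? toggle p I) then 1# else 0#

  T⁻ : Fin size → Subset size → Carrier
  T⁻ p I = if does (toggle p I ⊂? I) then 1# else 0#

  Σ : (Fin size → Carrier) → Carrier
  Σ g = foldr (λ p acc → g p + acc) 0# (allFinL size)

data Hat (n : ℕ) : Set where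
  bot : Hat n
  el  : Fin n → Hat n
  top : Hat n

module PiecewiseLinear {c ℓ} (F : OrderedField c ℓ) (P : FinPoset) where
  open OrderedField F
  open FinPoset P

  _<̂_ : Hat size → Hat size → Bool
  bot  <̂ bot  = false
  bot  <̂ el _ = true
  bot  <̂ top  = true
  el _ <̂ bot  = false
  el p <̂ el q = does (p ≼? q) ∧ not (does (p ≟ q))
  el _ <̂ top  = true
  top  <̂ _    = false

  allHat : List (Hat size)
  allHat = bot ∷ (map el (allFinL size) ++ (top ∷ []))

  covers : Hat size → Hat size → Bool
  covers y x = (x <̂ y) ∧ not (any (λ z → (x <̂ z) ∧ (z <̂ y)) allHat)

  ext : (Fin size → Carrier) → Hat size → Carrier
  ext f bot    = 0#
  ext f (el p) = f p
  ext f top    = 1#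

  -- max / min of a list (the lists used below are always nonempty;
  -- the [] cases are never reached)
  maxL : List Carrier → Carrier
  maxL []       = 0#
  maxL (x ∷ xs) = foldr max x xs

  minL : List Carrier → Carrier
  minL []       = 1#
  minL (x ∷ xs) = foldr min x xs

  TPL⁺ : Fin size → (Fin size → Carrier) → Carrier
  TPL⁺ p f = f p - maxL (map (ext f) (filterᵇ (λ q → covers (el p) q) allHat))

  TPL⁻ : Fin size → (Fin size → Carrier) → Carrier
  TPL⁻ p f = minL (map (ext f) (filterᵇ (λ q → covers q (el p)) allHat)) - f p

  InOrderPolytope : (Fin size → Carrier) → Set ℓ
  InOrderPolytope f = (∀ p → (0# ≤ f p) × (f p ≤ 1#)) × (∀ p q → p ≼ q → f p ≤ f q)

module Submission where

-- The PL toggle sum Φ h = Σ_p c⁺_p (h p − max of h below p) + c⁻_p (min of h above p − h p)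
-- makes sense for every function h on P̂. For an order ideal I and t ≥ 0, let χ be t times the
-- indicator of P̂ ∖ I; its PL toggles are t 𝒯_{p±}(I), so Φ χ = t δ by hypothesis. Φ is additive
-- on comonotone pairs, because the maxima over lower covers and minima over upper covers then add.
-- A monotone h on P̂ with h 0̂ = 0 splits comonotonically as χ + h′, with t the least positive
-- value of h, I the zero set of h, and h′ again monotone but with more zeros; by induction
-- Φ h = h(1̂) δ, and f ∈ 𝒪(P) is the case h(1̂) = 1.

open import Defs
open import Data.Fin using (Fin)
open import Data.Fin.Subset using (Subset)

open import Level using (Level; _⊔_)
open import Data.Bool using (true; if_then_else_; T; _∧_)
open import Data.Bool.ListAction using (any)
open import Data.Bool.Properties using (T-∧; T-≡; T-not-≡)
open import Data.Empty using (⊥-elim)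
open import Data.Fin.Properties using (any?; _≟_)
open import Data.Fin.Subset using (_∈_; _∉_; _∪_; _∩_; ∁; ⁅_⁆; _⊂_; _⊆_; ∣_∣)
open import Data.Fin.Subset.Properties
  using (_∈?_; _⊂?_; x∈⁅x⁆; x∈⁅y⁆⇒x≡y; x∈p∪q⁻; x∈p∪q⁺; x∈p∩q⁻; x∈p∩q⁺; p⊆p∪q; p∩q⊆p;
         x∈∁p⇒x∉p; x∉p⇒x∈∁p; ⊆-reflexive; p⊂q⇒∣p∣<∣q∣; p⊂q⇒∁p⊃∁q; ∣p∣≤n)
open import Data.List using (List; []; _∷_; map; foldr; filterᵇ; allFin)
open import Data.List.Membership.Propositional using (find) renaming (_∈_ to _∈ˡ_)
open import Data.List.Membership.Propositional.Properties
  using (∈-filter⁺; ∈-filter⁻; ∈-map⁺; ∈-++⁺ˡ; ∈-++⁺ʳ; ∈-allFin)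
open import Data.List.Relation.Unary.Any using (here; there)
open import Data.List.Relation.Unary.Any.Properties using (any⁻)
open import Data.Maybe using (nothing)
open import Data.Nat as ℕ using (zero; suc)
import Data.Nat.Properties as ℕ
open import Data.Product using (∃-syntax; _×_; _,_; proj₁; proj₂)
open import Data.Sum using (_⊎_; inj₁; inj₂)
open import Data.Vec using (tabulate)
open import Data.Vec.Properties using (lookup∘tabulate; []=⇒lookup; lookup⇒[]=)
open import Function using (Equivalence; flip; _∘_)
open import Relation.Nullary using (¬_; Dec; yes; no; does)
open import Relation.Nullary.Decidable using (dec-true; dec-false; decidable-stable; _×-dec_; ¬?)
open import Relation.Nullary.Decidable.Core using (T?)
open import Relation.Nullary.Negation using (contradiction)
open import Relation.Unary using (Pred)
import Relation.Unary as U
open import Relation.Binary using (Rel; Transitive; IsPartialOrder; IsTotalOrder; TotalOrder)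
import Relation.Binary as B
import Relation.Binary.Construct.Flip.EqAndOrd as Flip
import Relation.Binary.Construct.NonStrictToStrict as NonStrictToStrict
import Relation.Binary.Properties.TotalOrder as TotalOrderProperties
import Relation.Binary.Reasoning.PartialOrder
import Relation.Binary.Reasoning.Setoid
open import Relation.Binary.PropositionalEquality as ≡ using (_≡_)
open import Tactic.RingSolver.Core.AlmostCommutativeRing using (fromCommutativeRing)

private variable
  a : Level
  A : Set a

-- Maximal elements of a finite decidable set

module _ {r s} {_≺_ : Rel A r} {S : Pred A s}
         (≺-irrefl : ∀ x → ¬ x ≺ x) (≺-trans : Transitive _≺_)
         (_≺?_ : B.Decidable _≺_) (S? : U.Decidable S) where

  search-maximal-∈ : ∀ xs →
    (∃[ m ] S m × (∀ {w} → w ∈ˡ xs → S w → ¬ m ≺ w)) ⊎ (∀ {w} → w ∈ˡ xs → ¬ S w)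
  search-maximal-∈ [] = inj₂ λ ()
  search-maximal-∈ (x ∷ xs) with search-maximal-∈ xs | S? x
  ... | inj₂ none | no ¬Sx = inj₂ λ { (here ≡.refl) → ¬Sx ; (there w∈) → none w∈ }
  ... | inj₂ none | yes Sx =
    inj₁ (x , Sx , λ { (here ≡.refl) _ → ≺-irrefl x ; (there w∈) Sw → contradiction Sw (none w∈) })
  ... | inj₁ (m , Sm , max) | no ¬Sx =
    inj₁ (m , Sm , λ { (here ≡.refl) Sx → contradiction Sx ¬Sx ; (there w∈) → max w∈ })
  ... | inj₁ (m , Sm , max) | yes Sx with m ≺? x
  ...   | yes m≺x = inj₁ (x , Sx , λ { (here ≡.refl) _ → ≺-irrefl x
                                     ; (there w∈) Sw x≺w → max w∈ Sw (≺-trans m≺x x≺w) })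
  ...   | no m⊀x = inj₁ (m , Sm , λ { (here ≡.refl) _ → m⊀x ; (there w∈) → max w∈ })

  search-maximal : ∀ xs → (∀ w → w ∈ˡ xs) →
    (∃[ m ] S m × (∀ {w} → S w → ¬ m ≺ w)) ⊎ (∀ w → ¬ S w)
  search-maximal xs complete with search-maximal-∈ xs
  ... | inj₁ (m , Sm , max) = inj₁ (m , Sm , λ {w} → max (complete w))
  ... | inj₂ none = inj₂ λ w → none (complete w)

-- Ordered fields

module OrderedFieldProperties {c ℓ} (F : OrderedField c ℓ) where
  open OrderedField F
  open IsTotalOrder isTotalOrder public
    using (total; antisym; ≲-respˡ-≈; ≲-respʳ-≈)
    renaming (refl to ≤-refl; trans to ≤-trans; reflexive to ≤-reflexive)
  totalOrder : TotalOrder c ℓ ℓ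
  totalOrder = record { isTotalOrder = isTotalOrder }

  open TotalOrderProperties totalOrder public using (≰⇒≥)
  open import Tactic.RingSolver.NonReflective (fromCommutativeRing commutativeRing (λ _ → nothing))
    using (solve; _⊜_; _⊕_; _⊗_; ⊝_)
  module ≈-Reasoning = Relation.Binary.Reasoning.Setoid setoid
  module ≤-Reasoning = Relation.Binary.Reasoning.PartialOrder (TotalOrder.poset totalOrder)
  open ≈-Reasoning
  open import Algebra.Properties.Ring ring using (-0#≈0#; -1*x≈-x; -‿involutive)

  infix 4 _<_
  _<_ : Rel Carrier ℓ
  x < y = ¬ (y ≤ x)

  <-irrefl : ∀ x → ¬ x < x
  <-irrefl x x<x = x<x ≤-refl

  <-trans : Transitive _<_
  <-trans x<y y<z z≤x = y<z (≤-trans z≤x (≰⇒≥ x<y))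

  +-mono-≤₂ : ∀ {x y u v} → x ≤ y → u ≤ v → x + u ≤ y + v
  +-mono-≤₂ {x} {y} {u} {v} x≤y u≤v =
    ≤-trans (+-mono-≤ u x≤y) (≲-respʳ-≈ (+-comm v y) (≲-respˡ-≈ (+-comm u y) (+-mono-≤ y u≤v)))

  x≤y⇒x-z≤y-z : ∀ {x y} z → x ≤ y → x - z ≤ y - z
  x≤y⇒x-z≤y-z z = +-mono-≤ (- z)

  x-x≈0 : ∀ x → x - x ≈ 0#
  x-x≈0 = -‿inverseʳ

  x≤y⇒0≤y-x : ∀ {x y} → x ≤ y → 0# ≤ y - x
  x≤y⇒0≤y-x {x} x≤y = ≲-respˡ-≈ (x-x≈0 x) (x≤y⇒x-z≤y-z x x≤y)

  x-0≈x : ∀ x → x - 0# ≈ x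
  x-0≈x x = trans (+-congˡ -0#≈0#) (+-identityʳ x)

  x≡0⇒t*x≈0 : ∀ t {x} → x ≡ 0# → t * x ≈ 0#
  x≡0⇒t*x≈0 t ≡.refl = zeroʳ t

  x≡1⇒t*x≈t : ∀ t {x} → x ≡ 1# → t * x ≈ t
  x≡1⇒t*x≈t t ≡.refl = *-identityʳ t

  sub-cong : ∀ {x x' y y'} → x ≈ x' → y ≈ y' → x - y ≈ x' - y'
  sub-cong x≈x' y≈y' = +-cong x≈x' (-‿cong y≈y')

  0≤1 : 0# ≤ 1#
  0≤1 with total 0# 1#
  ... | inj₁ 0≤1 = 0≤1
  ... | inj₂ 1≤0 = ≲-respʳ-≈ [-1]*[-1]≈1 (*-nonneg 0≤-1 0≤-1)
    where
    0≤-1 : 0# ≤ - 1#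
    0≤-1 = ≲-respˡ-≈ (x-x≈0 1#) (≲-respʳ-≈ (+-identityˡ (- 1#)) (+-mono-≤ (- 1#) 1≤0))
    [-1]*[-1]≈1 : - 1# * - 1# ≈ 1#
    [-1]*[-1]≈1 = trans (-1*x≈-x (- 1#)) (-‿involutive 1#)

  y+[x-y]≈x : ∀ x y → y + (x - y) ≈ x
  y+[x-y]≈x x y = begin
    y + (x - y)    ≈⟨ +-comm y (x - y) ⟩
    (x - y) + y    ≈⟨ +-assoc x (- y) y ⟩
    x + (- y + y)  ≈⟨ +-congˡ (-‿inverseˡ y) ⟩
    x + 0#         ≈⟨ +-identityʳ x ⟩
    x              ∎

  [x+y]-[u+v]≈[x-u]+[y-v] : ∀ x y u v → (x + y) - (u + v) ≈ (x - u) + (y - v)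
  [x+y]-[u+v]≈[x-u]+[y-v] = solve 4 (λ x y u v →
    ((x ⊕ y) ⊕ ⊝ (u ⊕ v)) ⊜ ((x ⊕ ⊝ u) ⊕ (y ⊕ ⊝ v))) refl

  +-interchange : ∀ x y u v → (x + y) + (u + v) ≈ (x + u) + (y + v)
  +-interchange = solve 4 (λ x y u v → ((x ⊕ y) ⊕ (u ⊕ v)) ⊜ ((x ⊕ u) ⊕ (y ⊕ v))) refl

  *-+-interchange : ∀ a b x y u v → a * (x + y) + b * (u + v) ≈ (a * x + b * u) + (a * y + b * v)
  *-+-interchange = solve 6 (λ a b x y u v →
    ((a ⊗ (x ⊕ y)) ⊕ (b ⊗ (u ⊕ v))) ⊜ (((a ⊗ x) ⊕ (b ⊗ u)) ⊕ ((a ⊗ y) ⊕ (b ⊗ v)))) refl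

  *-scale-combination : ∀ a b t x y → a * (t * x) + b * (t * y) ≈ t * (a * x + b * y)
  *-scale-combination = solve 5 (λ a b t x y →
    ((a ⊗ (t ⊗ x)) ⊕ (b ⊗ (t ⊗ y))) ⊜ (t ⊗ ((a ⊗ x) ⊕ (b ⊗ y)))) refl

  t*x+[s-t]*x≈s*x : ∀ t s x → t * x + (s - t) * x ≈ s * x
  t*x+[s-t]*x≈s*x t s x = trans (sym (distribʳ x t (s - t))) (*-congʳ (y+[x-y]≈x s t))

  -- With ⊑ taken to be ≥ (module Min below) IsGreatest means "is the least".
  module Greatest (_⊑_ : Rel Carrier ℓ) (⊑-isTotalOrder : IsTotalOrder _≈_ _⊑_)
      (+-mono-⊑ : ∀ {x y u v} → x ⊑ y → u ⊑ v → (x + u) ⊑ (y + v))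
      (_∨_ : Carrier → Carrier → Carrier) (∨-sel : ∀ x y → x ∨ y ≡ x ⊎ x ∨ y ≡ y)
      (x⊑x∨y : ∀ x y → x ⊑ (x ∨ y)) (y⊑x∨y : ∀ x y → y ⊑ (x ∨ y)) where
    open IsTotalOrder ⊑-isTotalOrder using ()
      renaming (refl to ⊑-refl; trans to ⊑-trans; reflexive to ⊑-reflexive; antisym to ⊑-antisym;
                ≲-respˡ-≈ to ⊑-respˡ-≈)

    IsGreatest : {A : Set a} → List A → (A → Carrier) → Carrier → Set (a ⊔ ℓ)
    IsGreatest xs g m = (∃[ z ] z ∈ˡ xs × m ≈ g z) × (∀ {z} → z ∈ˡ xs → g z ⊑ m)

    Comonotone : {A : Set a} → (A → Carrier) → (A → Carrier) → Set (a ⊔ ℓ)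
    Comonotone f g = ∀ x y → (f x ⊑ f y × g x ⊑ g y) ⊎ (f y ⊑ f x × g y ⊑ g x)

    ∨-isGreatest : ∀ {g : A → Carrier} {y x xs m} →
      IsGreatest (y ∷ xs) g m → IsGreatest (y ∷ x ∷ xs) g (g x ∨ m)
    ∨-isGreatest {g = g} {y} {x} {xs} {m} ((z , z∈ , m≈gz) , bounded) = attained (∨-sel (g x) m) , bounded′
      where
      skip : ∀ {w} → w ∈ˡ y ∷ xs → w ∈ˡ y ∷ x ∷ xs
      skip (here w≡y) = here w≡y
      skip (there w∈) = there (there w∈)
      attained : g x ∨ m ≡ g x ⊎ g x ∨ m ≡ m → ∃[ w ] w ∈ˡ y ∷ x ∷ xs × g x ∨ m ≈ g w
      attained (inj₁ eq) = x , there (here ≡.refl) , reflexive eq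
      attained (inj₂ eq) = z , skip z∈ , trans (reflexive eq) m≈gz
      bounded′ : ∀ {w} → w ∈ˡ y ∷ x ∷ xs → g w ⊑ (g x ∨ m)
      bounded′ (here ≡.refl) = ⊑-trans (bounded (here ≡.refl)) (y⊑x∨y (g x) m)
      bounded′ (there (here ≡.refl)) = x⊑x∨y (g x) m
      bounded′ (there (there w∈)) = ⊑-trans (bounded (there w∈)) (y⊑x∨y (g x) m)

    foldr-isGreatest : ∀ (g : A → Carrier) y xs → IsGreatest (y ∷ xs) g (foldr _∨_ (g y) (map g xs))
    foldr-isGreatest g y [] = (y , here ≡.refl , refl) , λ { (here ≡.refl) → ⊑-refl }
    foldr-isGreatest g y (x ∷ xs) = ∨-isGreatest (foldr-isGreatest g y xs)

    isGreatest-unique : ∀ {xs} {g : A → Carrier} {m m′} →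
      IsGreatest xs g m → IsGreatest xs g m′ → m ≈ m′
    isGreatest-unique ((z , z∈ , m≈gz) , bounded) ((z′ , z′∈ , m′≈gz′) , bounded′) =
      ⊑-antisym (⊑-respˡ-≈ (sym m≈gz) (bounded′ z∈)) (⊑-respˡ-≈ (sym m′≈gz′) (bounded z′∈))

    isGreatest-cong : ∀ {xs} {g g′ : A → Carrier} {m} →
      (∀ z → g z ≈ g′ z) → IsGreatest xs g m → IsGreatest xs g′ m
    isGreatest-cong g≈g′ ((z , z∈ , m≈gz) , bounded) =
      (z , z∈ , trans m≈gz (g≈g′ z)) , λ {w} w∈ → ⊑-respˡ-≈ (g≈g′ w) (bounded w∈)

    isGreatest-const : ∀ {xs} {g : A → Carrier} {v z} →
      z ∈ˡ xs → (∀ {w} → w ∈ˡ xs → g w ≈ v) → IsGreatest xs g v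
    isGreatest-const z∈ g≈v = (_ , z∈ , sym (g≈v z∈)) , λ w∈ → ⊑-reflexive (g≈v w∈)

    isGreatest-+ : ∀ {xs} {f g : A → Carrier} {m n} → Comonotone f g →
      IsGreatest xs f m → IsGreatest xs g n → IsGreatest xs (λ z → f z + g z) (m + n)
    isGreatest-+ {f = f} {g} {m} {n} comonotone ((u , u∈ , m≈fu) , f⊑m) ((v , v∈ , n≈gv) , g⊑n) =
      attained (comonotone u v) , λ w∈ → +-mono-⊑ (f⊑m w∈) (g⊑n w∈)
      where
      attained : _ → ∃[ w ] w ∈ˡ _ × m + n ≈ f w + g w
      attained (inj₁ (fu⊑fv , _)) =
        v , v∈ , +-cong (⊑-antisym (⊑-respˡ-≈ (sym m≈fu) fu⊑fv) (f⊑m v∈)) n≈gv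
      attained (inj₂ (_ , gv⊑gu)) =
        u , u∈ , +-cong m≈fu (⊑-antisym (⊑-respˡ-≈ (sym n≈gv) gv⊑gu) (g⊑n u∈))

  max-sel : ∀ x y → max x y ≡ x ⊎ max x y ≡ y
  max-sel x y with x ≤? y
  ... | yes _ = inj₂ ≡.refl
  ... | no _ = inj₁ ≡.refl

  x≤max[x,y] : ∀ x y → x ≤ max x y
  x≤max[x,y] x y with x ≤? y
  ... | yes x≤y = x≤y
  ... | no _ = ≤-refl

  y≤max[x,y] : ∀ x y → y ≤ max x y
  y≤max[x,y] x y with x ≤? y
  ... | yes _ = ≤-refl
  ... | no x≰y = ≰⇒≥ x≰y

  min-sel : ∀ x y → min x y ≡ x ⊎ min x y ≡ y
  min-sel x y with x ≤? y
  ... | yes _ = inj₁ ≡.refl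
  ... | no _ = inj₂ ≡.refl

  min[x,y]≤x : ∀ x y → min x y ≤ x
  min[x,y]≤x x y with x ≤? y
  ... | yes _ = ≤-refl
  ... | no x≰y = ≰⇒≥ x≰y

  min[x,y]≤y : ∀ x y → min x y ≤ y
  min[x,y]≤y x y with x ≤? y
  ... | yes x≤y = x≤y
  ... | no _ = ≤-refl

  module Max = Greatest _≤_ isTotalOrder +-mono-≤₂ max max-sel x≤max[x,y] y≤max[x,y]
  module Min = Greatest (flip _≤_) (Flip.isTotalOrder isTotalOrder) +-mono-≤₂
                 min min-sel min[x,y]≤x min[x,y]≤y

  ∑ : List A → (A → Carrier) → Carrier
  ∑ xs g = foldr (λ x acc → g x + acc) 0# xs

  ∑-cong : ∀ xs {g g′ : A → Carrier} → (∀ x → g x ≈ g′ x) → ∑ xs g ≈ ∑ xs g′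
  ∑-cong [] _ = refl
  ∑-cong (x ∷ xs) g≈g′ = +-cong (g≈g′ x) (∑-cong xs g≈g′)

  ∑-+ : ∀ xs (f g : A → Carrier) → ∑ xs (λ x → f x + g x) ≈ ∑ xs f + ∑ xs g
  ∑-+ [] f g = sym (+-identityʳ 0#)
  ∑-+ (x ∷ xs) f g = trans (+-congˡ (∑-+ xs f g)) (+-interchange (f x) (g x) (∑ xs f) (∑ xs g))

  ∑-*ˡ : ∀ xs t (g : A → Carrier) → ∑ xs (λ x → t * g x) ≈ t * ∑ xs g
  ∑-*ˡ [] t g = sym (zeroʳ t)
  ∑-*ˡ (x ∷ xs) t g = trans (+-congˡ (∑-*ˡ xs t g)) (sym (distribˡ t (g x) (∑ xs g)))

module PLToggles {c ℓ} (F : OrderedField c ℓ) (P : FinPoset) where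
  open OrderedField F
  open OrderedFieldProperties F
  open FinPoset P
  open IsPartialOrder isPartialOrder using () renaming (refl to ≼-refl; trans to ≼-trans)
  open NonStrictToStrict _≡_ _≼_ using (<⇒≤) renaming (_<_ to _≺_)
  open Combinatorial P
  open Indicators F P
  open PiecewiseLinear F P

  _≺?_ : B.Decidable _≺_
  _≺?_ = NonStrictToStrict.<-decidable _≡_ _≼_ _≟_ _≼?_

  ≺-trans : Transitive _≺_
  ≺-trans = NonStrictToStrict.<-trans _≡_ _≼_ isPartialOrder

  ≺-irrefl : ∀ p → ¬ p ≺ p
  ≺-irrefl p = NonStrictToStrict.<-irrefl _≡_ _≼_ ≡.refl

  infix 4 _≤̂_
  data _≤̂_ : Hat size → Hat size → Set where
    bot≤̂  : ∀ {z} → bot ≤̂ z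
    ≤̂top  : ∀ {z} → z ≤̂ top
    el≤̂el : ∀ {p q} → p ≼ q → el p ≤̂ el q

  Monotone : (Hat size → Carrier) → Set ℓ
  Monotone h = ∀ {x y} → x ≤̂ y → h x ≤ h y

  ext-monotone : ∀ {f} → InOrderPolytope f → Monotone (ext f)
  ext-monotone (bounded , mono) (bot≤̂ {bot})  = ≤-refl
  ext-monotone (bounded , mono) (bot≤̂ {el p}) = proj₁ (bounded p)
  ext-monotone (bounded , mono) (bot≤̂ {top})  = 0≤1
  ext-monotone (bounded , mono) (≤̂top {bot})  = 0≤1
  ext-monotone (bounded , mono) (≤̂top {el p}) = proj₂ (bounded p)
  ext-monotone (bounded , mono) (≤̂top {top})  = ≤-refl
  ext-monotone (bounded , mono) (el≤̂el p≼q)   = mono _ _ p≼q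

  -- Covers in P̂

  <̂-el⁺ : ∀ {p q} → p ≺ q → T (el p <̂ el q)
  <̂-el⁺ {p} {q} (p≼q , p≢q) = Equivalence.from T-∧
    (Equivalence.from T-≡ (dec-true (p ≼? q) p≼q) , Equivalence.from T-not-≡ (dec-false (p ≟ q) p≢q))

  <̂-el⁻ : ∀ {p q} → T (el p <̂ el q) → p ≺ q
  <̂-el⁻ {p} {q} p<q with p ≼? q | p ≟ q
  ... | yes p≼q | no p≢q = p≼q , p≢q
  ... | yes _   | yes _  = ⊥-elim p<q
  ... | no _    | _      = ⊥-elim p<q

  ∈-allHat : ∀ z → z ∈ˡ allHat
  ∈-allHat bot    = here ≡.refl
  ∈-allHat (el p) = there (∈-++⁺ˡ (∈-map⁺ el (∈-allFin p)))
  ∈-allHat top    = there (∈-++⁺ʳ (map el (allFin size)) (here ≡.refl))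

  covers-intro : ∀ {x y} → T (x <̂ y) → (∀ z → T (x <̂ z) → ¬ T (z <̂ y)) → T (covers y x)
  covers-intro {x} {y} x<y nothing-between =
    Equivalence.from T-∧ (x<y , Equivalence.from T-not-≡ (dec-false (T? _) no-witness))
    where
    no-witness : ¬ T (any (λ z → (x <̂ z) ∧ (z <̂ y)) allHat)
    no-witness between with find (any⁻ _ allHat between)
    ... | z , _ , x<z<y = let x<z , z<y = Equivalence.to T-∧ x<z<y in nothing-between z x<z z<y

  covers⇒<̂ : ∀ {x y} → T (covers y x) → T (x <̂ y)
  covers⇒<̂ x⋖y = proj₁ (Equivalence.to T-∧ x⋖y)

  lowerCover-above : ∀ {q p} → q ≺ p → ∃[ r ] q ≼ r × T (covers (el p) (el r))
  lowerCover-above {q} {p} q≺p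
    with search-maximal ≺-irrefl ≺-trans _≺?_ (λ w → q ≼? w ×-dec w ≺? p) (allFin size) ∈-allFin
  ... | inj₂ none = contradiction (≼-refl , q≺p) (none q)
  ... | inj₁ (r , (q≼r , r≺p) , maximal) = r , q≼r , covers-intro (<̂-el⁺ r≺p) nothing-between
    where
    nothing-between : ∀ z → T (el r <̂ z) → ¬ T (z <̂ el p)
    nothing-between bot    ()
    nothing-between (el w) r<w w<p = maximal (≼-trans q≼r (<⇒≤ (<̂-el⁻ r<w)) , <̂-el⁻ w<p) (<̂-el⁻ r<w)
    nothing-between top    _   ()

  upperCover-below : ∀ {p q} → p ≺ q → ∃[ r ] r ≼ q × T (covers (el r) (el p))
  upperCover-below {p} {q} p≺q
    with search-maximal ≺-irrefl (flip ≺-trans) (flip _≺?_) (λ w → p ≺? w ×-dec w ≼? q)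
                        (allFin size) ∈-allFin
  ... | inj₂ none = contradiction (p≺q , ≼-refl) (none q)
  ... | inj₁ (r , (p≺r , r≼q) , minimal) = r , r≼q , covers-intro (<̂-el⁺ p≺r) nothing-between
    where
    nothing-between : ∀ z → T (el p <̂ z) → ¬ T (z <̂ el r)
    nothing-between bot    ()
    nothing-between (el w) p<w w<r = minimal (<̂-el⁻ p<w , ≼-trans (<⇒≤ (<̂-el⁻ w<r)) r≼q) (<̂-el⁻ w<r)
    nothing-between top    _   ()

  minimal⇒covers-bot : ∀ {p} → (∀ q → ¬ q ≺ p) → T (covers (el p) bot)
  minimal⇒covers-bot {p} none = covers-intro {bot} {el p} _ λ
    { bot    ()
    ; (el q) _ q<p → none q (<̂-el⁻ q<p)
    ; top    _ ()
    }

  maximal⇒covered-by-top : ∀ {p} → (∀ q → ¬ p ≺ q) → T (covers top (el p))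
  maximal⇒covered-by-top {p} none = covers-intro {el p} {top} _ λ
    { bot    ()
    ; (el q) p<q _ → none q (<̂-el⁻ p<q)
    ; top    _ ()
    }

  lowerCovers upperCovers : Fin size → List (Hat size)
  lowerCovers p = filterᵇ (λ z → covers (el p) z) allHat
  upperCovers p = filterᵇ (λ z → covers z (el p)) allHat

  ∈-lowerCovers⁺ : ∀ {p z} → T (covers (el p) z) → z ∈ˡ lowerCovers p
  ∈-lowerCovers⁺ {p} {z} = ∈-filter⁺ (T? ∘ covers (el p)) (∈-allHat z)

  ∈-lowerCovers⁻ : ∀ {p z} → z ∈ˡ lowerCovers p → T (covers (el p) z)
  ∈-lowerCovers⁻ {p} z∈ = proj₂ (∈-filter⁻ (T? ∘ covers (el p)) {xs = allHat} z∈)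

  ∈-upperCovers⁺ : ∀ {p z} → T (covers z (el p)) → z ∈ˡ upperCovers p
  ∈-upperCovers⁺ {p} {z} = ∈-filter⁺ (T? ∘ flip covers (el p)) (∈-allHat z)

  ∈-upperCovers⁻ : ∀ {p z} → z ∈ˡ upperCovers p → T (covers z (el p))
  ∈-upperCovers⁻ {p} z∈ = proj₂ (∈-filter⁻ (T? ∘ flip covers (el p)) {xs = allHat} z∈)

  lowerCovers-nonempty : ∀ p → ∃[ z ] z ∈ˡ lowerCovers p
  lowerCovers-nonempty p with any? (_≺? p)
  ... | yes (q , q≺p) = let r , _ , r⋖p = lowerCover-above q≺p in el r , ∈-lowerCovers⁺ r⋖p
  ... | no none = bot , ∈-lowerCovers⁺ (minimal⇒covers-bot λ q q≺p → none (q , q≺p))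

  upperCovers-nonempty : ∀ p → ∃[ z ] z ∈ˡ upperCovers p
  upperCovers-nonempty p with any? (p ≺?_)
  ... | yes (q , p≺q) = let r , _ , p⋖r = upperCover-below p≺q in el r , ∈-upperCovers⁺ p⋖r
  ... | no none = top , ∈-upperCovers⁺ (maximal⇒covered-by-top λ q p≺q → none (q , p≺q))

  maxBelow minAbove : (Hat size → Carrier) → Fin size → Carrier
  maxBelow h p = maxL (map h (lowerCovers p))
  minAbove h p = minL (map h (upperCovers p))

  maxBelow-isGreatest : ∀ h p → Max.IsGreatest (lowerCovers p) h (maxBelow h p)
  maxBelow-isGreatest h p = greatest (lowerCovers p) (lowerCovers-nonempty p)
    where
    greatest : ∀ zs → ∃[ z ] z ∈ˡ zs → Max.IsGreatest zs h (maxL (map h zs))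
    greatest []       (_ , ())
    greatest (y ∷ ys) _ = Max.foldr-isGreatest h y ys

  minAbove-isLeast : ∀ h p → Min.IsGreatest (upperCovers p) h (minAbove h p)
  minAbove-isLeast h p = least (upperCovers p) (upperCovers-nonempty p)
    where
    least : ∀ zs → ∃[ z ] z ∈ˡ zs → Min.IsGreatest zs h (minL (map h zs))
    least []       (_ , ())
    least (y ∷ ys) _ = Min.foldr-isGreatest h y ys

  -- TPL⁺ p f is TPL⁺ʰ (ext f) p by definition, and similarly for TPL⁻.
  TPL⁺ʰ TPL⁻ʰ : (Hat size → Carrier) → Fin size → Carrier
  TPL⁺ʰ h p = h (el p) - maxBelow h p
  TPL⁻ʰ h p = minAbove h p - h (el p)

  module _ {h h′ : Hat size → Carrier} (h≈h′ : ∀ z → h z ≈ h′ z) where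

    TPL⁺ʰ-cong : ∀ p → TPL⁺ʰ h p ≈ TPL⁺ʰ h′ p
    TPL⁺ʰ-cong p = sub-cong (h≈h′ (el p)) (Max.isGreatest-unique
      (Max.isGreatest-cong h≈h′ (maxBelow-isGreatest h p)) (maxBelow-isGreatest h′ p))

    TPL⁻ʰ-cong : ∀ p → TPL⁻ʰ h p ≈ TPL⁻ʰ h′ p
    TPL⁻ʰ-cong p = sub-cong (Min.isGreatest-unique
      (Min.isGreatest-cong h≈h′ (minAbove-isLeast h p)) (minAbove-isLeast h′ p)) (h≈h′ (el p))

  module _ {f g : Hat size → Carrier} (comonotone : Max.Comonotone f g) where

    TPL⁺ʰ-+ : ∀ p → TPL⁺ʰ (λ z → f z + g z) p ≈ TPL⁺ʰ f p + TPL⁺ʰ g p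
    TPL⁺ʰ-+ p = trans
      (sub-cong refl (Max.isGreatest-unique (maxBelow-isGreatest _ p)
        (Max.isGreatest-+ comonotone (maxBelow-isGreatest f p) (maxBelow-isGreatest g p))))
      ([x+y]-[u+v]≈[x-u]+[y-v] (f (el p)) (g (el p)) (maxBelow f p) (maxBelow g p))

    TPL⁻ʰ-+ : ∀ p → TPL⁻ʰ (λ z → f z + g z) p ≈ TPL⁻ʰ f p + TPL⁻ʰ g p
    TPL⁻ʰ-+ p = trans
      (sub-cong (Min.isGreatest-unique (minAbove-isLeast _ p)
        (Min.isGreatest-+ (flip comonotone) (minAbove-isLeast f p) (minAbove-isLeast g p))) refl)
      ([x+y]-[u+v]≈[x-u]+[y-v] (minAbove f p) (minAbove g p) (f (el p)) (g (el p)))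

  -- Toggles at an order ideal

  toggle-insert : ∀ {p I} → p ∉ I → IsIdeal (I ∪ ⁅ p ⁆) → toggle p I ≡ I ∪ ⁅ p ⁆
  toggle-insert {p} {I} p∉I ideal with p ∈? I
  ... | yes p∈I = contradiction p∈I p∉I
  ... | no _ rewrite dec-true (isIdeal? (I ∪ ⁅ p ⁆)) ideal = ≡.refl

  toggle-∉-stuck : ∀ {p I} → p ∉ I → ¬ IsIdeal (I ∪ ⁅ p ⁆) → toggle p I ≡ I
  toggle-∉-stuck {p} {I} p∉I not-ideal with p ∈? I
  ... | yes p∈I = contradiction p∈I p∉I
  ... | no _ rewrite dec-false (isIdeal? (I ∪ ⁅ p ⁆)) not-ideal = ≡.refl

  toggle-remove : ∀ {p I} → p ∈ I → IsIdeal (I ∩ ∁ ⁅ p ⁆) → toggle p I ≡ I ∩ ∁ ⁅ p ⁆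
  toggle-remove {p} {I} p∈I ideal with p ∈? I
  ... | no p∉I = contradiction p∈I p∉I
  ... | yes _ rewrite dec-true (isIdeal? (I ∩ ∁ ⁅ p ⁆)) ideal = ≡.refl

  toggle-∈-stuck : ∀ {p I} → p ∈ I → ¬ IsIdeal (I ∩ ∁ ⁅ p ⁆) → toggle p I ≡ I
  toggle-∈-stuck {p} {I} p∈I not-ideal with p ∈? I
  ... | no p∉I = contradiction p∈I p∉I
  ... | yes _ rewrite dec-false (isIdeal? (I ∩ ∁ ⁅ p ⁆)) not-ideal = ≡.refl

  toggle-⊆ : ∀ {p I} → p ∈ I → toggle p I ⊆ I
  toggle-⊆ {p} {I} p∈I with isIdeal? (I ∩ ∁ ⁅ p ⁆)
  ... | yes ideal    = ≡.subst (_⊆ I) (≡.sym (toggle-remove p∈I ideal)) (p∩q⊆p I (∁ ⁅ p ⁆))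
  ... | no not-ideal = ⊆-reflexive (toggle-∈-stuck p∈I not-ideal)

  toggle-⊇ : ∀ {p I} → p ∉ I → I ⊆ toggle p I
  toggle-⊇ {p} {I} p∉I with isIdeal? (I ∪ ⁅ p ⁆)
  ... | yes ideal    = ≡.subst (I ⊆_) (≡.sym (toggle-insert p∉I ideal)) (p⊆p∪q ⁅ p ⁆)
  ... | no not-ideal = ⊆-reflexive (≡.sym (toggle-∉-stuck p∉I not-ideal))

  T⁺≡1 : ∀ {p I} → I ⊂ toggle p I → T⁺ p I ≡ 1#
  T⁺≡1 {p} {I} I⊂J rewrite dec-true (I ⊂? toggle p I) I⊂J = ≡.refl

  T⁺≡0 : ∀ {p I} → toggle p I ⊆ I → T⁺ p I ≡ 0#
  T⁺≡0 {p} {I} J⊆I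
    rewrite dec-false (I ⊂? toggle p I) λ { (_ , _ , x∈J , x∉I) → x∉I (J⊆I x∈J) } = ≡.refl

  T⁻≡1 : ∀ {p I} → toggle p I ⊂ I → T⁻ p I ≡ 1#
  T⁻≡1 {p} {I} J⊂I rewrite dec-true (toggle p I ⊂? I) J⊂I = ≡.refl

  T⁻≡0 : ∀ {p I} → I ⊆ toggle p I → T⁻ p I ≡ 0#
  T⁻≡0 {p} {I} I⊆J
    rewrite dec-false (toggle p I ⊂? I) λ { (_ , _ , x∈I , x∉J) → x∉J (I⊆J x∈I) } = ≡.refl

  x∉I∖x : ∀ {p} {I : Subset size} → p ∉ I ∩ ∁ ⁅ p ⁆
  x∉I∖x {p} {I} p∈ = x∈∁p⇒x∉p (proj₂ (x∈p∩q⁻ I _ p∈)) (x∈⁅x⁆ p)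

  module _ {I : Subset size} (ideal : IsIdeal I) where

    ∪-⁅⁆-isIdeal : ∀ {p} → (∀ {q} → q ≺ p → q ∈ I) → IsIdeal (I ∪ ⁅ p ⁆)
    ∪-⁅⁆-isIdeal {p} below x y y≼x x∈ with x∈p∪q⁻ I ⁅ p ⁆ x∈
    ... | inj₁ x∈I = x∈p∪q⁺ (inj₁ (ideal x y y≼x x∈I))
    ... | inj₂ x∈⁅p⁆ with x∈⁅y⁆⇒x≡y p x∈⁅p⁆ | y ≟ x
    ...   | ≡.refl | yes ≡.refl = x∈p∪q⁺ (inj₂ (x∈⁅x⁆ y))
    ...   | ≡.refl | no y≢x     = x∈p∪q⁺ (inj₁ (below (y≼x , y≢x)))

    ∩-∁⁅⁆-isIdeal : ∀ {p} → (∀ {q} → p ≺ q → q ∉ I) → IsIdeal (I ∩ ∁ ⁅ p ⁆)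
    ∩-∁⁅⁆-isIdeal {p} above x y y≼x x∈ with x∈p∩q⁻ I (∁ ⁅ p ⁆) x∈
    ... | x∈I , x∉⁅p⁆ = x∈p∩q⁺ (ideal x y y≼x x∈I , x∉p⇒x∈∁p y∉⁅p⁆)
      where
      y∉⁅p⁆ : y ∉ ⁅ p ⁆
      y∉⁅p⁆ y∈⁅p⁆ with x∈⁅y⁆⇒x≡y p y∈⁅p⁆
      ... | ≡.refl = above (y≼x , λ { ≡.refl → x∈∁p⇒x∉p x∉⁅p⁆ (x∈⁅x⁆ y) }) x∈I

    T⁺-∈ : ∀ {p} → p ∈ I → T⁺ p I ≡ 0#
    T⁺-∈ {p} p∈I = T⁺≡0 {p} (toggle-⊆ p∈I)

    T⁺-addable : ∀ {p} → p ∉ I → (∀ {q} → q ≺ p → q ∈ I) → T⁺ p I ≡ 1#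
    T⁺-addable {p} p∉I below = T⁺≡1 {p}
      (≡.subst (I ⊂_) (≡.sym (toggle-insert p∉I (∪-⁅⁆-isIdeal below)))
        (p⊆p∪q ⁅ p ⁆ , p , x∈p∪q⁺ (inj₂ (x∈⁅x⁆ p)) , p∉I))

    T⁺-blocked : ∀ {p q} → p ∉ I → q ≺ p → q ∉ I → T⁺ p I ≡ 0#
    T⁺-blocked {p} {q} p∉I (q≼p , q≢p) q∉I = T⁺≡0 {p} (⊆-reflexive (toggle-∉-stuck p∉I not-ideal))
      where
      not-ideal : ¬ IsIdeal (I ∪ ⁅ p ⁆)
      not-ideal ideal′ with x∈p∪q⁻ I ⁅ p ⁆ (ideal′ p q q≼p (x∈p∪q⁺ (inj₂ (x∈⁅x⁆ p))))
      ... | inj₁ q∈I    = q∉I q∈I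
      ... | inj₂ q∈⁅p⁆ = q≢p (x∈⁅y⁆⇒x≡y p q∈⁅p⁆)

    T⁻-∉ : ∀ {p} → p ∉ I → T⁻ p I ≡ 0#
    T⁻-∉ {p} p∉I = T⁻≡0 {p} (toggle-⊇ p∉I)

    T⁻-removable : ∀ {p} → p ∈ I → (∀ {q} → p ≺ q → q ∉ I) → T⁻ p I ≡ 1#
    T⁻-removable {p} p∈I above = T⁻≡1 {p}
      (≡.subst (_⊂ I) (≡.sym (toggle-remove p∈I (∩-∁⁅⁆-isIdeal above)))
        (p∩q⊆p I (∁ ⁅ p ⁆) , p , p∈I , x∉I∖x))

    T⁻-blocked : ∀ {p q} → p ∈ I → p ≺ q → q ∈ I → T⁻ p I ≡ 0#
    T⁻-blocked {p} {q} p∈I (p≼q , p≢q) q∈I =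
      T⁻≡0 {p} (⊆-reflexive (≡.sym (toggle-∈-stuck p∈I not-ideal)))
      where
      not-ideal : ¬ IsIdeal (I ∩ ∁ ⁅ p ⁆)
      not-ideal ideal′ = x∉I∖x (ideal′ q p p≼q
        (x∈p∩q⁺ (q∈I , x∉p⇒x∈∁p λ q∈⁅p⁆ → p≢q (≡.sym (x∈⁅y⁆⇒x≡y p q∈⁅p⁆)))))

  -- For an ideal I, t times the vertex of 𝒪(P) at the filter P ∖ I, extended to P̂.
  vertex : Subset size → Carrier → Hat size → Carrier
  vertex I t bot    = 0#
  vertex I t (el p) = if does (p ∈? I) then 0# else t
  vertex I t top    = t

  vertex-∈ : ∀ {I t p} → p ∈ I → vertex I t (el p) ≡ 0#
  vertex-∈ {I} {t} {p} p∈I rewrite dec-true (p ∈? I) p∈I = ≡.refl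

  vertex-∉ : ∀ {I t p} → p ∉ I → vertex I t (el p) ≡ t
  vertex-∉ {I} {t} {p} p∉I rewrite dec-false (p ∈? I) p∉I = ≡.refl

  module _ {t} (0≤t : 0# ≤ t) {I : Subset size} where

    vertex-nonneg : ∀ z → 0# ≤ vertex I t z
    vertex-nonneg bot    = ≤-refl
    vertex-nonneg (el p) with p ∈? I
    ... | yes _ = ≤-refl
    ... | no _  = 0≤t
    vertex-nonneg top    = 0≤t

    vertex-≤ : ∀ z → vertex I t z ≤ t
    vertex-≤ bot    = 0≤t
    vertex-≤ (el p) with p ∈? I
    ... | yes _ = 0≤t
    ... | no _  = ≤-refl
    vertex-≤ top    = ≤-refl

  module _ {I : Subset size} (ideal : IsIdeal I) {t} (0≤t : 0# ≤ t) where
    open ≈-Reasoning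

    maxBelow-vertex-0 : ∀ {p} → (∀ {q} → q ≺ p → q ∈ I) → maxBelow (vertex I t) p ≈ 0#
    maxBelow-vertex-0 {p} below = Max.isGreatest-unique (maxBelow-isGreatest _ p)
      (Max.isGreatest-const (proj₂ (lowerCovers-nonempty p)) lower-zero)
      where
      lower-zero : ∀ {z} → z ∈ˡ lowerCovers p → vertex I t z ≈ 0#
      lower-zero {bot}  _  = refl
      lower-zero {el q} z∈ = reflexive (vertex-∈ (below (<̂-el⁻ (covers⇒<̂ (∈-lowerCovers⁻ z∈)))))
      lower-zero {top}  z∈ = ⊥-elim (covers⇒<̂ {top} {el p} (∈-lowerCovers⁻ {p} z∈))

    maxBelow-vertex-t : ∀ {p q} → q ≺ p → q ∉ I → maxBelow (vertex I t) p ≈ t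
    maxBelow-vertex-t {p} q≺p q∉I with lowerCover-above q≺p
    ... | r , q≼r , r⋖p = Max.isGreatest-unique (maxBelow-isGreatest _ p)
      ((el r , ∈-lowerCovers⁺ r⋖p , sym (reflexive (vertex-∉ r∉I))) , λ {z} _ → vertex-≤ 0≤t z)
      where
      r∉I : r ∉ I
      r∉I r∈I = q∉I (ideal _ _ q≼r r∈I)

    minAbove-vertex-t : ∀ {p} → (∀ {q} → p ≺ q → q ∉ I) → minAbove (vertex I t) p ≈ t
    minAbove-vertex-t {p} above = Min.isGreatest-unique (minAbove-isLeast _ p)
      (Min.isGreatest-const (proj₂ (upperCovers-nonempty p)) upper-t)
      where
      upper-t : ∀ {z} → z ∈ˡ upperCovers p → vertex I t z ≈ t
      upper-t {bot}  z∈ = ⊥-elim (covers⇒<̂ {el p} {bot} (∈-upperCovers⁻ {p} z∈))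
      upper-t {el q} z∈ = reflexive (vertex-∉ (above (<̂-el⁻ (covers⇒<̂ (∈-upperCovers⁻ z∈)))))
      upper-t {top}  _  = refl

    minAbove-vertex-0 : ∀ {p q} → p ≺ q → q ∈ I → minAbove (vertex I t) p ≈ 0#
    minAbove-vertex-0 {p} p≺q q∈I with upperCover-below p≺q
    ... | r , r≼q , p⋖r = Min.isGreatest-unique (minAbove-isLeast _ p)
      ((el r , ∈-upperCovers⁺ p⋖r , sym (reflexive (vertex-∈ (ideal _ _ r≼q q∈I)))) ,
       λ {z} _ → vertex-nonneg 0≤t z)

    TPL⁺-vertex : ∀ p → TPL⁺ʰ (vertex I t) p ≈ t * T⁺ p I
    TPL⁺-vertex p = by-membership (p ∈? I)
      where
      by-membership : Dec (p ∈ I) → TPL⁺ʰ (vertex I t) p ≈ t * T⁺ p I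
      by-blocker : p ∉ I → Dec (∃[ q ] q ≺ p × q ∉ I) → TPL⁺ʰ (vertex I t) p ≈ t * T⁺ p I

      by-membership (yes p∈I) = begin
        vertex I t (el p) - maxBelow (vertex I t) p
          ≈⟨ sub-cong (reflexive (vertex-∈ p∈I)) (maxBelow-vertex-0 λ q≺p → ideal p _ (<⇒≤ q≺p) p∈I) ⟩
        0# - 0#     ≈⟨ x-x≈0 0# ⟩
        0#          ≈⟨ x≡0⇒t*x≈0 t (T⁺-∈ ideal p∈I) ⟨
        t * T⁺ p I  ∎
      by-membership (no p∉I) = by-blocker p∉I (any? λ q → q ≺? p ×-dec ¬? (q ∈? I))

      by-blocker p∉I (yes (q , q≺p , q∉I)) = begin
        vertex I t (el p) - maxBelow (vertex I t) p
          ≈⟨ sub-cong (reflexive (vertex-∉ p∉I)) (maxBelow-vertex-t q≺p q∉I) ⟩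
        t - t       ≈⟨ x-x≈0 t ⟩
        0#          ≈⟨ x≡0⇒t*x≈0 t (T⁺-blocked ideal p∉I q≺p q∉I) ⟨
        t * T⁺ p I  ∎
      by-blocker p∉I (no none) = begin
        vertex I t (el p) - maxBelow (vertex I t) p
          ≈⟨ sub-cong (reflexive (vertex-∉ p∉I)) (maxBelow-vertex-0 below) ⟩
        t - 0#      ≈⟨ x-0≈x t ⟩
        t           ≈⟨ x≡1⇒t*x≈t t (T⁺-addable ideal p∉I below) ⟨
        t * T⁺ p I  ∎
        where
        below : ∀ {q} → q ≺ p → q ∈ I
        below {q} q≺p = decidable-stable (q ∈? I) λ q∉I → none (q , q≺p , q∉I)

    TPL⁻-vertex : ∀ p → TPL⁻ʰ (vertex I t) p ≈ t * T⁻ p I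
    TPL⁻-vertex p = by-membership (p ∈? I)
      where
      by-membership : Dec (p ∈ I) → TPL⁻ʰ (vertex I t) p ≈ t * T⁻ p I
      by-blocker : p ∈ I → Dec (∃[ q ] p ≺ q × q ∈ I) → TPL⁻ʰ (vertex I t) p ≈ t * T⁻ p I

      by-membership (no p∉I) = begin
        minAbove (vertex I t) p - vertex I t (el p)
          ≈⟨ sub-cong (minAbove-vertex-t λ p≺q q∈I → p∉I (ideal _ p (<⇒≤ p≺q) q∈I))
                      (reflexive (vertex-∉ p∉I)) ⟩
        t - t       ≈⟨ x-x≈0 t ⟩
        0#          ≈⟨ x≡0⇒t*x≈0 t (T⁻-∉ ideal p∉I) ⟨
        t * T⁻ p I  ∎
      by-membership (yes p∈I) = by-blocker p∈I (any? λ q → p ≺? q ×-dec q ∈? I)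

      by-blocker p∈I (yes (q , p≺q , q∈I)) = begin
        minAbove (vertex I t) p - vertex I t (el p)
          ≈⟨ sub-cong (minAbove-vertex-0 p≺q q∈I) (reflexive (vertex-∈ p∈I)) ⟩
        0# - 0#     ≈⟨ x-x≈0 0# ⟩
        0#          ≈⟨ x≡0⇒t*x≈0 t (T⁻-blocked ideal p∈I p≺q q∈I) ⟨
        t * T⁻ p I  ∎
      by-blocker p∈I (no none) = begin
        minAbove (vertex I t) p - vertex I t (el p)
          ≈⟨ sub-cong (minAbove-vertex-t above) (reflexive (vertex-∈ p∈I)) ⟩
        t - 0#      ≈⟨ x-0≈x t ⟩
        t           ≈⟨ x≡1⇒t*x≈t t (T⁻-removable ideal p∈I above) ⟨
        t * T⁻ p I  ∎
        where
        above : ∀ {q} → p ≺ q → q ∉ I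
        above {q} p≺q q∈I = none (q , p≺q , q∈I)

  -- Layer-cake decomposition

  zeroSet : (Hat size → Carrier) → Subset size
  zeroSet h = tabulate λ p → does (h (el p) ≤? 0#)

  ∈-zeroSet⁺ : ∀ {h p} → h (el p) ≤ 0# → p ∈ zeroSet h
  ∈-zeroSet⁺ {h} {p} h≤0 =
    lookup⇒[]= p (zeroSet h) (≡.trans (lookup∘tabulate _ p) (dec-true (h (el p) ≤? 0#) h≤0))

  ∈-zeroSet⁻ : ∀ {h p} → p ∈ zeroSet h → h (el p) ≤ 0#
  ∈-zeroSet⁻ {h} {p} p∈ = decidable-stable (h (el p) ≤? 0#) λ h≰0 →
    contradiction (≡.trans (≡.sym does≡true) (dec-false (h (el p) ≤? 0#) h≰0)) λ ()
    where
    does≡true : does (h (el p) ≤? 0#) ≡ true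
    does≡true = ≡.trans (≡.sym (lookup∘tabulate _ p)) ([]=⇒lookup p∈)

  least-nonzero : ∀ h →
    (∃[ m ] m ∉ zeroSet h × (∀ {p} → p ∉ zeroSet h → h (el m) ≤ h (el p))) ⊎ (∀ p → p ∈ zeroSet h)
  least-nonzero h with search-maximal {_≺_ = λ x y → h (el y) < h (el x)} (λ x → <-irrefl (h (el x)))
                         (flip <-trans) (λ x y → ¬? (h (el x) ≤? h (el y))) (λ p → ¬? (p ∈? zeroSet h))
                         (allFin size) ∈-allFin
  ... | inj₁ (m , m∉ , least) =
    inj₁ (m , m∉ , λ {p} p∉ → decidable-stable (h (el m) ≤? h (el p)) (least p∉))
  ... | inj₂ none = inj₂ λ p → decidable-stable (p ∈? zeroSet h) (none p)

  -- These h are exactly the functions h(1̂) f with f ∈ 𝒪(P), extended to P̂.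
  module Cone {h : Hat size → Carrier} (mono : Monotone h) (h[bot]≈0 : h bot ≈ 0#) where

    zeroSet-isIdeal : IsIdeal (zeroSet h)
    zeroSet-isIdeal p q q≼p p∈ = ∈-zeroSet⁺ {h} (≤-trans (mono (el≤̂el q≼p)) (∈-zeroSet⁻ {h} p∈))

    0≤h : ∀ z → 0# ≤ h z
    0≤h z = ≲-respˡ-≈ h[bot]≈0 (mono bot≤̂)

    layer-view : ∀ {t} → t ≤ h top → (∀ {p} → p ∉ zeroSet h → t ≤ h (el p)) → ∀ z →
      (vertex (zeroSet h) t z ≡ 0# × h z ≈ 0#) ⊎ (vertex (zeroSet h) t z ≡ t × t ≤ h z)
    layer-view _     _     bot    = inj₁ (≡.refl , h[bot]≈0)
    layer-view _     t≤pos (el p) with p ∈? zeroSet h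
    ... | yes p∈ = inj₁ (≡.refl , antisym (∈-zeroSet⁻ {h} p∈) (0≤h (el p)))
    ... | no p∉  = inj₂ (≡.refl , t≤pos p∉)
    layer-view t≤top _     top    = inj₂ (≡.refl , t≤top)

    module Peel {m} (m∉ : m ∉ zeroSet h) (least : ∀ {p} → p ∉ zeroSet h → h (el m) ≤ h (el p)) where

      t : Carrier
      t = h (el m)

      0<t : 0# < t
      0<t t≤0 = m∉ (∈-zeroSet⁺ {h} t≤0)

      0≤t : 0# ≤ t
      0≤t = ≰⇒≥ 0<t

      layer rest : Hat size → Carrier
      layer = vertex (zeroSet h) t
      rest z = h z - layer z

      view : ∀ z → (layer z ≡ 0# × h z ≈ 0#) ⊎ (layer z ≡ t × t ≤ h z)
      view = layer-view (mono ≤̂top) least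

      rest-zero : ∀ {z} → layer z ≡ 0# → rest z ≈ h z
      rest-zero {z} l≡0 = trans (sub-cong refl (reflexive l≡0)) (x-0≈x (h z))

      rest-low : ∀ {z} → layer z ≡ 0# → h z ≈ 0# → rest z ≈ 0#
      rest-low l≡0 h≈0 = trans (rest-zero l≡0) h≈0

      rest-high : ∀ {z} → layer z ≡ t → rest z ≈ h z - t
      rest-high l≡t = sub-cong refl (reflexive l≡t)

      rest-nonneg : ∀ z → 0# ≤ rest z
      rest-nonneg z with view z
      ... | inj₁ (l≡0 , h≈0) = ≤-reflexive (sym (rest-low l≡0 h≈0))
      ... | inj₂ (l≡t , t≤h) = ≲-respʳ-≈ (sym (rest-high l≡t)) (x≤y⇒0≤y-x t≤h)

      layer-rest-monotone : ∀ {x y} → h x ≤ h y → layer x ≤ layer y × rest x ≤ rest y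
      layer-rest-monotone {x} {y} hx≤hy with view x | view y
      ... | inj₁ (lx≡0 , hx≈0) | _ =
        ≲-respˡ-≈ (sym (reflexive lx≡0)) (vertex-nonneg 0≤t y) ,
        ≲-respˡ-≈ (sym (rest-low lx≡0 hx≈0)) (rest-nonneg y)
      ... | inj₂ (_ , t≤hx) | inj₁ (_ , hy≈0) =
        contradiction (≤-trans t≤hx (≲-respʳ-≈ hy≈0 hx≤hy)) 0<t
      ... | inj₂ (lx≡t , _) | inj₂ (ly≡t , _) =
        ≤-reflexive (reflexive (≡.trans lx≡t (≡.sym ly≡t))) , (begin
        rest x  ≈⟨ rest-high lx≡t ⟩
        h x - t ≤⟨ x≤y⇒x-z≤y-z t hx≤hy ⟩
        h y - t ≈⟨ rest-high ly≡t ⟨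
        rest y  ∎)
        where open ≤-Reasoning

      comonotone : Max.Comonotone layer rest
      comonotone x y with total (h x) (h y)
      ... | inj₁ hx≤hy = inj₁ (layer-rest-monotone hx≤hy)
      ... | inj₂ hy≤hx = inj₂ (layer-rest-monotone hy≤hx)

      rest-monotone : Monotone rest
      rest-monotone x≤̂y = proj₂ (layer-rest-monotone (mono x≤̂y))

      rest[bot]≈0 : rest bot ≈ 0#
      rest[bot]≈0 = trans (x-0≈x (h bot)) h[bot]≈0

      h≈layer+rest : ∀ z → h z ≈ layer z + rest z
      h≈layer+rest z = sym (y+[x-y]≈x (h z) (layer z))

      zeroSet-grows : zeroSet h ⊂ zeroSet rest
      zeroSet-grows = stays-zero , m , ∈-zeroSet⁺ {rest} (≤-reflexive rest[m]≈0) , m∉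
        where
        stays-zero : zeroSet h ⊆ zeroSet rest
        stays-zero p∈ = ∈-zeroSet⁺ {rest} (≲-respˡ-≈ (sym (rest-zero (vertex-∈ p∈))) (∈-zeroSet⁻ {h} p∈))
        rest[m]≈0 : rest (el m) ≈ 0#
        rest[m]≈0 = trans (rest-high (vertex-∉ m∉)) (x-x≈0 t)

  module Combination (c⁺ c⁻ : Fin size → Carrier) where

    ΣTPL : (Hat size → Carrier) → Carrier
    ΣTPL h = Σ λ p → c⁺ p * TPL⁺ʰ h p + c⁻ p * TPL⁻ʰ h p

    ΣTPL-cong : ∀ {h h′} → (∀ z → h z ≈ h′ z) → ΣTPL h ≈ ΣTPL h′
    ΣTPL-cong h≈h′ = ∑-cong (allFin size) λ p →
      +-cong (*-congˡ (TPL⁺ʰ-cong h≈h′ p)) (*-congˡ (TPL⁻ʰ-cong h≈h′ p))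

    ΣTPL-+ : ∀ {f g} → Max.Comonotone f g → ΣTPL (λ z → f z + g z) ≈ ΣTPL f + ΣTPL g
    ΣTPL-+ {f} {g} comonotone = trans
      (∑-cong (allFin size) λ p → trans
        (+-cong (*-congˡ (TPL⁺ʰ-+ comonotone p)) (*-congˡ (TPL⁻ʰ-+ comonotone p)))
        (*-+-interchange (c⁺ p) (c⁻ p) (TPL⁺ʰ f p) (TPL⁺ʰ g p) (TPL⁻ʰ f p) (TPL⁻ʰ g p)))
      (∑-+ (allFin size) _ _)

    ΣTPL-vertex : ∀ {I t} → IsIdeal I → 0# ≤ t →
      ΣTPL (vertex I t) ≈ t * Σ (λ p → c⁺ p * T⁺ p I + c⁻ p * T⁻ p I)
    ΣTPL-vertex {I} {t} ideal 0≤t = trans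
      (∑-cong (allFin size) λ p → trans
        (+-cong (*-congˡ (TPL⁺-vertex ideal 0≤t p)) (*-congˡ (TPL⁻-vertex ideal 0≤t p)))
        (*-scale-combination (c⁺ p) (c⁻ p) t (T⁺ p I) (T⁻ p I)))
      (∑-*ˡ (allFin size) t _)

    module _ {δ} (hyp : ∀ I → IsIdeal I → Σ (λ p → c⁺ p * T⁺ p I + c⁻ p * T⁻ p I) ≈ δ) where

      ΣTPL-vertex≈t*δ : ∀ {I t} → IsIdeal I → 0# ≤ t → ΣTPL (vertex I t) ≈ t * δ
      ΣTPL-vertex≈t*δ ideal 0≤t = trans (ΣTPL-vertex ideal 0≤t) (*-congˡ (hyp _ ideal))

      ΣTPL-flat : ∀ {h} → Monotone h → h bot ≈ 0# → (∀ p → p ∈ zeroSet h) → ΣTPL h ≈ h top * δ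
      ΣTPL-flat {h} mono h[bot]≈0 all-zero =
        trans (ΣTPL-cong h≈vertex) (ΣTPL-vertex≈t*δ zeroSet-isIdeal (0≤h top))
        where
        open Cone mono h[bot]≈0
        h≈vertex : ∀ z → h z ≈ vertex (zeroSet h) (h top) z
        h≈vertex z with layer-view ≤-refl (λ {p} p∉ → contradiction (all-zero p) p∉) z
        ... | inj₁ (v≡0 , h≈0)     = trans h≈0 (sym (reflexive v≡0))
        ... | inj₂ (v≡top , top≤h) = trans (antisym (mono ≤̂top) top≤h) (sym (reflexive v≡top))

      ΣTPL-cone-bounded : ∀ n {h} → ∣ ∁ (zeroSet h) ∣ ℕ.< n →
        Monotone h → h bot ≈ 0# → ΣTPL h ≈ h top * δ
      ΣTPL-cone-bounded zero    ()
      ΣTPL-cone-bounded (suc n) {h} support<n mono h[bot]≈0 with least-nonzero h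
      ... | inj₂ all-zero = ΣTPL-flat mono h[bot]≈0 all-zero
      ... | inj₁ (m , m∉ , least) = begin
        ΣTPL h                         ≈⟨ ΣTPL-cong h≈layer+rest ⟩
        ΣTPL (λ z → layer z + rest z)  ≈⟨ ΣTPL-+ comonotone ⟩
        ΣTPL layer + ΣTPL rest         ≈⟨ +-cong (ΣTPL-vertex≈t*δ zeroSet-isIdeal 0≤t) rest-case ⟩
        t * δ + (h top - t) * δ        ≈⟨ t*x+[s-t]*x≈s*x t (h top) δ ⟩
        h top * δ                      ∎
        where
        open ≈-Reasoning
        open Cone mono h[bot]≈0
        open Peel m∉ least
        support′<n : ∣ ∁ (zeroSet rest) ∣ ℕ.< n
        support′<n = ℕ.<-≤-trans (p⊂q⇒∣p∣<∣q∣ (p⊂q⇒∁p⊃∁q zeroSet-grows)) (ℕ.≤-pred support<n)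
        rest-case : ΣTPL rest ≈ (h top - t) * δ
        rest-case = ΣTPL-cone-bounded n support′<n rest-monotone rest[bot]≈0

      ΣTPL-cone : ∀ {h} → Monotone h → h bot ≈ 0# → ΣTPL h ≈ h top * δ
      ΣTPL-cone {h} = ΣTPL-cone-bounded (suc size) (ℕ.s≤s (∣p∣≤n (∁ (zeroSet h))))

lemma4p30 : ∀ {c ℓ} (F : OrderedField c ℓ) (P : FinPoset)
    (c⁺ c⁻ : Fin (FinPoset.size P) → OrderedField.Carrier F)
    (δ : OrderedField.Carrier F) →
    (∀ (I : Subset (FinPoset.size P)) → Combinatorial.IsIdeal P I →
      OrderedField._≈_ F
        (Indicators.Σ F P (λ p → OrderedField._+_ F
          (OrderedField._*_ F (c⁺ p) (Indicators.T⁺ F P p I))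
          (OrderedField._*_ F (c⁻ p) (Indicators.T⁻ F P p I))))
        δ) →
    ∀ (f : Fin (FinPoset.size P) → OrderedField.Carrier F) →
      PiecewiseLinear.InOrderPolytope F P f →
      OrderedField._≈_ F
        (Indicators.Σ F P (λ p → OrderedField._+_ F
          (OrderedField._*_ F (c⁺ p) (PiecewiseLinear.TPL⁺ F P p f))
          (OrderedField._*_ F (c⁻ p) (PiecewiseLinear.TPL⁻ F P p f))))
        δ
lemma4p30 F P c⁺ c⁻ δ hyp f f∈𝒪 = trans (ΣTPL-cone hyp (ext-monotone f∈𝒪) refl) (*-identityˡ δ)
  where
  open OrderedField F
  open PLToggles F P
  open Combination c⁺ c⁻
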